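{- If an oriented graph $\Gamma$ contains the configuration $\mathbf{K}$, the tournament on four vertices $a,b,c,d$ with arcs $a\to b$, $b\to c$, $c\to d$, $d\to a$, $a\to c$, $d\to b$, then $\Gamma$ is not polymorphism homogeneous.
   Context: An oriented graph is a pair $\Gamma=(V,E)$ with $V$ a non-empty set and $E\subseteq V^2$ an asymmetric relation; write $x\to y$ for $(x,y)\in E$. $\Gamma$ contains a configuration $\Delta$ if some induced subgraph of $\Gamma$ is isomorphic to $\Delta$. A homomorphism is an arc-preserving map; $\Gamma$ is homomorphism homogeneous if every homomorphism between finite induced subgraphs extends to an endomorphism. The $n$-th direct power $\Gamma^n$ has vertex set $V^n$ and arcs $((v_1,\dots,v_n),(w_1,\dots,w_n))$ with $(v_i,w_i)\in E$ for all $i$. $\Gamma$ is polymorphism homogeneous if $\Gamma^n$ is homomorphism homogeneous for every positive integer $n$. -}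

module Defs where

open import Data.Nat using (ℕ; zero; suc)
open import Data.Fin using (Fin; zero; suc)
open import Data.Vec using (Vec; lookup)
open import Data.Product using (Σ; _×_; _,_)
open import Data.Empty using (⊥)
open import Relation.Nullary using (¬_)
open import Relation.Binary.PropositionalEquality using (_≡_)
open import Function.Definitions using (Injective)
open import Function.Bundles using (_⇔_)

record Digraph : Set₁ where
  field
    V : Set
    E : V → V → Set

record OrientedGraph : Set₁ where
  field
    V        : Set
    E        : V → V → Set
    nonEmpty : V
    asym     : ∀ {x y} → E x y → ¬ E y x

  digraph : Digraph
  digraph = record { V = V ; E = E }

module _ (Γ : Digraph) where
  open Digraph Γ

  -- A finite induced subgraph on n vertices: an injective listing Fin n → V
  -- (the subgraph is the image, with the induced arcs).
  record FinSub : Set where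
    field
      size  : ℕ
      elems : Fin size → V
      inj   : Injective _≡_ _≡_ elems
  open FinSub

  record SubHom (A B : FinSub) : Set where
    field
      fun      : Fin (size A) → Fin (size B)
      preserve : ∀ i j → E (elems A i) (elems A j) → E (elems B (fun i)) (elems B (fun j))

  record Endo : Set where
    field
      fun      : V → V
      preserve : ∀ x y → E x y → E (fun x) (fun y)

  HomomorphismHomogeneous : Set
  HomomorphismHomogeneous =
    ∀ (A B : FinSub) (h : SubHom A B) →
      Σ Endo λ g → ∀ i → Endo.fun g (elems A i) ≡ elems B (SubHom.fun h i)

_^ᵈ_ : Digraph → ℕ → Digraph
Γ ^ᵈ n = record
  { V = Vec (Digraph.V Γ) n
  ; E = λ v w → ∀ (i : Fin n) → Digraph.E Γ (lookup v i) (lookup w i) }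

PolymorphismHomogeneous : OrientedGraph → Set
PolymorphismHomogeneous Γ =
  ∀ (n : ℕ) → HomomorphismHomogeneous (OrientedGraph.digraph Γ ^ᵈ suc n)

-- The tournament K on a=0, b=1, c=2, d=3 with arcs
-- a→b, b→c, c→d, d→a, a→c, d→b.
data KArc : Fin 4 → Fin 4 → Set where
  ab : KArc zero (suc zero)
  bc : KArc (suc zero) (suc (suc zero))
  cd : KArc (suc (suc zero)) (suc (suc (suc zero)))
  da : KArc (suc (suc (suc zero))) zero
  ac : KArc zero (suc (suc zero))
  db : KArc (suc (suc (suc zero))) (suc zero)

-- Γ contains K: some induced subgraph is isomorphic to K, i.e. an injective
-- map Fin 4 → V that preserves and reflects arcs.
ContainsK : OrientedGraph → Set
ContainsK Γ =
  Σ (Fin 4 → OrientedGraph.V Γ) λ h →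
    Injective _≡_ _≡_ h × (∀ i j → OrientedGraph.E Γ (h i) (h j) ⇔ KArc i j)

{-# OPTIONS --safe #-}
module Submission where

-- In Γ², the embedded copy of K yields an induced path (b,a) → (c,b) → (d,c).
-- Collapsing its two non-adjacent ends onto (d,c) is a homomorphism of finite
-- induced subgraphs, but any extension g would have to send (c,b) to a vertex
-- with arcs both to and from (d,c), which asymmetry forbids.

open import Defs
open import Relation.Nullary using (¬_)
open import Data.Nat using (suc)
open import Data.Fin using (Fin; zero; suc)
open import Data.Vec using (Vec; lookup; _∷_; [])
open import Data.Product using (Σ; _,_)
open import Data.Empty using (⊥-elim)
open import Relation.Binary.Definitions using (Asymmetric)
open import Relation.Binary.PropositionalEquality using (_≡_; _≢_; refl; sym; cong; subst)
open import Function.Bundles using (Equivalence)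

^ᵈ-asymmetric : ∀ Γ n → Asymmetric (Digraph.E Γ) → Asymmetric (Digraph.E (Γ ^ᵈ suc n))
^ᵈ-asymmetric Γ n asym e e′ = asym (e zero) (e′ zero)

module _ (Γ : Digraph) where
  open Digraph Γ

  pointSub : V → FinSub Γ
  pointSub u = record { size = 1 ; elems = λ _ → u ; inj = λ { {zero} {zero} _ → refl } }

  pair : V → V → Fin 2 → V
  pair u w zero       = u
  pair u w (suc zero) = w

  pair-injective : ∀ {u w} → u ≢ w → ∀ {i j} → pair u w i ≡ pair u w j → i ≡ j
  pair-injective u≢w {zero}     {zero}     _  = refl
  pair-injective u≢w {zero}     {suc zero} eq = ⊥-elim (u≢w eq)
  pair-injective u≢w {suc zero} {zero}     eq = ⊥-elim (u≢w (sym eq))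
  pair-injective u≢w {suc zero} {suc zero} _  = refl

  pairSub : ∀ {u w} → u ≢ w → FinSub Γ
  pairSub {u} {w} u≢w = record { size = 2 ; elems = pair u w ; inj = pair-injective u≢w }

  collapse : ∀ {u w} (u≢w : u ≢ w) → ¬ E u u → ¬ E u w → ¬ E w u →
             SubHom Γ (pairSub u≢w) (pointSub w)
  collapse {u} {w} u≢w ¬u→u ¬u→w ¬w→u = record { fun = λ _ → zero ; preserve = preserve }
    where
    preserve : ∀ i j → E (pair u w i) (pair u w j) → E w w
    preserve zero       zero       e = ⊥-elim (¬u→u e)
    preserve zero       (suc zero) e = ⊥-elim (¬u→w e)
    preserve (suc zero) zero       e = ⊥-elim (¬w→u e)
    preserve (suc zero) (suc zero) e = e

  record Induced2Path : Set where
    field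
      {start middle end} : V
      start≢end    : start ≢ end
      ¬start→end   : ¬ E start end
      ¬end→start   : ¬ E end start
      start→middle : E start middle
      middle→end   : E middle end

  induced2Path⇒¬HomomorphismHomogeneous :
    Asymmetric E → Induced2Path → ¬ HomomorphismHomogeneous Γ
  induced2Path⇒¬HomomorphismHomogeneous asym p hh =
    noExtension (hh (pairSub start≢end) (pointSub end)
                    (collapse start≢end (λ e → asym e e) ¬start→end ¬end→start))
    where
    open Induced2Path p

    noExtension : ¬ Σ (Endo Γ) (λ g → ∀ i → Endo.fun g (pair start end i) ≡ end)
    noExtension (g , g-extends) = asym g[middle]→end end→g[middle]
      where
      open Endo g renaming (fun to g′)

      g[middle]→end : E (g′ middle) end
      g[middle]→end = subst (E (g′ middle)) (g-extends (suc zero)) (preserve middle end middle→end)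

      end→g[middle] : E end (g′ middle)
      end→g[middle] = subst (λ y → E y (g′ middle)) (g-extends zero) (preserve start middle start→middle)

containsK⇒induced2Path² : ∀ Γ → ContainsK Γ → Induced2Path (OrientedGraph.digraph Γ ^ᵈ 2)
containsK⇒induced2Path² Γ (v , v-injective , v-iso) = record
  { middle       = middle
  ; start≢end    = start≢end
  ; ¬start→end   = ¬start→end
  ; ¬end→start   = ¬end→start
  ; start→middle = start→middle
  ; middle→end   = middle→end
  }
  where
  open OrientedGraph Γ
  open Digraph (digraph ^ᵈ 2) using () renaming (E to E²)

  a b c d : Fin 4
  a = zero
  b = suc zero
  c = suc (suc zero)
  d = suc (suc (suc zero))

  start middle end : Vec V 2
  start  = v b ∷ v a ∷ []
  middle = v c ∷ v b ∷ []
  end    = v d ∷ v c ∷ []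

  embed : ∀ {i j} → KArc i j → E (v i) (v j)
  embed {i} {j} = Equivalence.from (v-iso i j)

  reflect : ∀ {i j} → E (v i) (v j) → KArc i j
  reflect {i} {j} = Equivalence.to (v-iso i j)

  start≢end : start ≢ end
  start≢end eq with v-injective (cong (λ p → lookup p zero) eq)
  ... | ()

  ¬start→end : ¬ E² start end
  ¬start→end e with reflect (e zero)
  ... | ()

  ¬end→start : ¬ E² end start
  ¬end→start e with reflect (e (suc zero))
  ... | ()

  start→middle : E² start middle
  start→middle zero       = embed bc
  start→middle (suc zero) = embed ab

  middle→end : E² middle end
  middle→end zero       = embed cd
  middle→end (suc zero) = embed bc

lemma3p4 : (Γ : OrientedGraph) → ContainsK Γ → ¬ PolymorphismHomogeneous Γ
lemma3p4 Γ K⊆Γ polyHom =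
  induced2Path⇒¬HomomorphismHomogeneous Γ² (λ {x y} → ^ᵈ-asymmetric digraph 1 asym {x} {y})
    (containsK⇒induced2Path² Γ K⊆Γ) (polyHom 1)
  where
  open OrientedGraph Γ
  Γ² = digraph ^ᵈ 2
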